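{- Let $P_T(x,y,z) = x^3+2x^2y+x^2z+2xy^2-2xyz-xz^2+2y^3-2yz^2+z^3$, and let $(T_n)_{n\in\mathbb{Z}}$ be the Tribonacci numbers defined by $T_0 = T_1 = 0$, $T_2 = 1$, and $T_n = T_{n-1}+T_{n-2}+T_{n-3}$ for all integers $n$ (so that for negative indices $T_n = T_{n+3} - T_{n+2} - T_{n+1}$). If $x, y, z$ are integers with $P_T(x,y,z) = 1$, then $(x,y,z) = (T_n, T_{n+1}, T_{n+2})$ for some integer $n$. -}

module Defs where

open import Data.Nat using (ℕ; zero; suc)
open import Data.Integer using (ℤ; +_; -[1+_]; _+_; _-_; _*_)
open import Data.Product using (_×_; _,_; proj₁)

P-T : ℤ → ℤ → ℤ → ℤ
P-T x y z =
  x * x * x + + 2 * x * x * y + x * x * z + + 2 * x * y * y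
  - + 2 * x * y * z - x * z * z + + 2 * y * y * y - + 2 * y * z * z + z * z * z

step : ℤ × ℤ × ℤ → ℤ × ℤ × ℤ
step (a , b , c) = (b , c , a + b + c)

-- inverse step, using T_n = T_{n+3} - T_{n+2} - T_{n+1}
back : ℤ × ℤ × ℤ → ℤ × ℤ × ℤ
back (a , b , c) = (c - b - a , a , b)

iterate : ℕ → (ℤ × ℤ × ℤ → ℤ × ℤ × ℤ) → ℤ × ℤ × ℤ → ℤ × ℤ × ℤ
iterate zero    f t = t
iterate (suc k) f t = f (iterate k f t)

-- Tribonacci on ℤ: T 0 = 0, T 1 = 0, T 2 = 1, T n = T (n-1) + T (n-2) + T (n-3) for all n ∈ ℤ.
-- tribTriple n = (T n , T (n+1) , T (n+2))
tribTriple : ℤ → ℤ × ℤ × ℤ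
tribTriple (+ k)    = iterate k step (+ 0 , + 0 , + 1)
tribTriple -[1+ k ] = iterate (suc k) back (+ 0 , + 0 , + 1)

T : ℤ → ℤ
T n = proj₁ (tribTriple n)

-- The shift step (a, b, c) ↦ (b, c, a + b + c) is a linear automorphism of P_T, with
-- inverse back, that maps Tribonacci triples to Tribonacci triples.  So it suffices to
-- show that every solution of P_T = 1 either is one of finitely many Tribonacci triples
-- or is moved by step, step² or back to a solution of smaller ℓ¹-norm.
--
-- Each octant of ℤ³ is the cone {a g₁ + b g₂ + c g₃ | a, b, c ∈ ℕ} spanned by three
-- signed unit vectors.  Replacing two generators g, h by g, g + h or by g + h, h
-- subdivides a cone into two; iterating, the octants split into finitely many subcones,
-- each settled by a computation on its generators:
--  * a shift lowers the norm of all three generators.  The norm is additive on the closed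
--    orthant containing them and subadditive everywhere, so the shift lowers the norm of
--    every nonzero point of the cone;
--  * P(a g₁ + b g₂ + c g₃), a cubic form in (a, b, c), has no positive coefficient, so it
--    never takes the value 1;
--  * the form has non-negative coefficients and cube coefficients P(gᵢ) ≥ 1, so it is at
--    least a³ + b³ + c³ ≥ a + b + c and takes the value 1 only at generators, which are
--    checked to be Tribonacci triples.

module Submission where

open import Defs
open import Data.Integer using (ℤ; +_; _+_)
open import Data.Product using (∃; _×_; _,_)
open import Relation.Binary.PropositionalEquality using (_≡_)

open import Data.Integer using (-[1+_]; _-_; _*_; -_; ∣_∣; sign; _◃_; 0ℤ; 1ℤ; -1ℤ; _≤_; _≤?_; +≤+; -≤+)
import Data.Integer.Properties as ℤ
open import Data.Integer.Base using (nonNegative)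
open import Data.Integer.Tactic.RingSolver as ℤ-Ring using (solve-∀)
open import Data.Nat as ℕ using (ℕ; zero; suc; z≤n; s≤s)
import Data.Nat.Properties as ℕ
open import Data.Nat.Induction using (<-wellFounded)
import Data.Nat.Tactic.RingSolver as ℕ-Ring
open import Data.Product using (proj₁)
import Data.Product.Properties as ×
open import Data.Sign using (Sign)
open import Data.Sum using (inj₁; inj₂)
open import Data.Vec using (Vec; []; _∷_)
open import Data.Vec.Relation.Unary.All using (All; []; _∷_; all?)
open import Function using (_∘_)
open import Induction.WellFounded using (module All)
open import Level using (0ℓ)
import Relation.Binary.Construct.On as On
open import Relation.Binary.PropositionalEquality using (refl; sym; trans; cong; cong₂; subst; subst₂; module ≡-Reasoning)
open import Relation.Nullary using (Dec; contradiction)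
open import Relation.Nullary.Decidable using (True; toWitness; _×-dec_; _→-dec_)
import Tactic.RingSolver.NonReflective ℤ-Ring.ring as E
open E using (solve; _⊜_; Expr; Κ)

-- Stated over an arbitrary ring signature so that, besides the integer instance used
-- throughout, the instance on the ring solver's expressions can restate identities
-- between these maps for `solve`.
module Polynomials {A : Set} (add mul : A → A → A) (neg : A → A) (#_ : ℕ → A) where

  infixl 6 _⊕_ _⊖_ _+ᵥ_
  infixl 7 _⊗_
  infixr 7 _·_
  infix  8 _∙_

  _⊕_ _⊗_ _⊖_ : A → A → A
  _⊕_ = add
  _⊗_ = mul
  x ⊖ y = x ⊕ neg y

  V : Set
  V = A × A × A

  Cone : Set
  Cone = V × V × V

  _+ᵥ_ : V → V → V
  (x , y , z) +ᵥ (x′ , y′ , z′) = (x ⊕ x′ , y ⊕ y′ , z ⊕ z′)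

  _·_ : A → V → V
  k · (x , y , z) = (k ⊗ x , k ⊗ y , k ⊗ z)

  _∙_ : V → V → A
  (x , y , z) ∙ (x′ , y′ , z′) = x ⊗ x′ ⊕ y ⊗ y′ ⊕ z ⊗ z′

  comb : A → A → A → Cone → V
  comb a b c (g₁ , g₂ , g₃) = a · g₁ +ᵥ b · g₂ +ᵥ c · g₃

  P : V → A
  P (x , y , z) =
    x ⊗ x ⊗ x ⊕ # 2 ⊗ x ⊗ x ⊗ y ⊕ x ⊗ x ⊗ z ⊕ # 2 ⊗ x ⊗ y ⊗ y ⊖ # 2 ⊗ x ⊗ y ⊗ z
    ⊖ x ⊗ z ⊗ z ⊕ # 2 ⊗ y ⊗ y ⊗ y ⊖ # 2 ⊗ y ⊗ z ⊗ z ⊕ z ⊗ z ⊗ z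

  ∇P : V → V
  ∇P (x , y , z) =
    ( # 3 ⊗ x ⊗ x ⊕ # 4 ⊗ x ⊗ y ⊕ # 2 ⊗ x ⊗ z ⊕ # 2 ⊗ y ⊗ y ⊖ # 2 ⊗ y ⊗ z ⊖ z ⊗ z
    , # 2 ⊗ x ⊗ x ⊕ # 4 ⊗ x ⊗ y ⊖ # 2 ⊗ x ⊗ z ⊕ # 6 ⊗ y ⊗ y ⊖ # 2 ⊗ z ⊗ z
    , x ⊗ x ⊖ # 2 ⊗ x ⊗ y ⊖ # 2 ⊗ x ⊗ z ⊖ # 4 ⊗ y ⊗ z ⊕ # 3 ⊗ z ⊗ z )

  forward : V → V
  forward (a , b , c) = (b , c , a ⊕ b ⊕ c)

  backward : V → V
  backward (a , b , c) = (c ⊖ b ⊖ a , a , b)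

  dot : ∀ {n} → Vec A n → Vec A n → A
  dot []       []       = # 0
  dot (c ∷ cs) (m ∷ ms) = c ⊗ m ⊕ dot cs ms

  cubes : A → A → A → Vec A 3
  cubes a b c = a ⊗ a ⊗ a ∷ b ⊗ b ⊗ b ∷ c ⊗ c ⊗ c ∷ []

  mixedMonomials : A → A → A → Vec A 7
  mixedMonomials a b c =
    a ⊗ a ⊗ b ∷ a ⊗ b ⊗ b ∷ a ⊗ a ⊗ c ∷ a ⊗ c ⊗ c ∷ b ⊗ b ⊗ c ∷ b ⊗ c ⊗ c ∷ a ⊗ b ⊗ c ∷ []

  cubeCoefficients : Cone → Vec A 3
  cubeCoefficients (g₁ , g₂ , g₃) = P g₁ ∷ P g₂ ∷ P g₃ ∷ []

  -- With Φ the symmetric trilinear form of P, ∇P u ∙ w = 3 Φ(u, u, w), and the last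
  -- coefficient is 6 Φ(g₁, g₂, g₃).
  mixedCoefficients : Cone → Vec A 7
  mixedCoefficients (g₁ , g₂ , g₃) =
    ∇P g₁ ∙ g₂ ∷ ∇P g₂ ∙ g₁ ∷ ∇P g₁ ∙ g₃ ∷ ∇P g₃ ∙ g₁ ∷ ∇P g₂ ∙ g₃ ∷ ∇P g₃ ∙ g₂ ∷
    ∇P (g₁ +ᵥ g₂) ∙ g₃ ⊖ ∇P g₁ ∙ g₃ ⊖ ∇P g₂ ∙ g₃ ∷ []

open Polynomials _+_ _*_ -_ +_ hiding (_⊕_; _⊗_; _⊖_; forward; backward)
module Syntax {n} = Polynomials {Expr ℤ n} E._⊕_ E._⊗_ E.⊝_ (Κ ∘ +_)

‖_‖ : V → ℕ
‖ x , y , z ‖ = ∣ x ∣ ℕ.+ ∣ y ∣ ℕ.+ ∣ z ∣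

map₃ : (V → V) → Cone → Cone
map₃ f (g₁ , g₂ , g₃) = (f g₁ , f g₂ , f g₃)

All₃ : (V → Set) → Cone → Set
All₃ Q (g₁ , g₂ , g₃) = Q g₁ × Q g₂ × Q g₃

all₃? : ∀ {Q : V → Set} → (∀ v → Dec (Q v)) → ∀ g → Dec (All₃ Q g)
all₃? Q? (g₁ , g₂ , g₃) = Q? g₁ ×-dec Q? g₂ ×-dec Q? g₃

pointwise : ∀ {x y z x′ y′ z′ : ℤ} → x ≡ x′ → y ≡ y′ → z ≡ z′ → (x , y , z) ≡ (x′ , y′ , z′)
pointwise refl refl refl = refl

IsTrib : V → Set
IsTrib v = ∃ λ n → v ≡ tribTriple n

Solved : V → Set
Solved v = P v ≡ 1ℤ → IsTrib v

step-back : ∀ v → step (back v) ≡ v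
step-back (x , y , z) = pointwise refl refl (cancel x y z)
  where
  cancel : ∀ x y z → z - y - x + x + y ≡ z
  cancel = solve-∀

back-step : ∀ v → back (step v) ≡ v
back-step (x , y , z) = pointwise (cancel x y z) refl refl
  where
  cancel : ∀ x y z → x + y + z - z - y ≡ x
  cancel = solve-∀

tribTriple-suc : ∀ n → tribTriple (n + 1ℤ) ≡ step (tribTriple n)
tribTriple-suc (+ k)        = cong (λ m → iterate m step (+ 0 , + 0 , + 1)) (ℕ.+-comm k 1)
tribTriple-suc -[1+ zero  ] = refl
tribTriple-suc -[1+ suc k ] = sym (step-back _)

tribTriple-pred : ∀ n → back (tribTriple n) ≡ tribTriple (n - 1ℤ)
tribTriple-pred (+ zero)  = refl
tribTriple-pred (+ suc k) = back-step _
tribTriple-pred -[1+ k ]  = cong (λ m → iterate (suc (suc m)) back (+ 0 , + 0 , + 1)) (sym (ℕ.+-identityʳ k))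

tribTriple-components : ∀ n → tribTriple n ≡ (T n , T (n + + 1) , T (n + + 2))
tribTriple-components n =
  pointwise refl (cong proj₁ (sym (tribTriple-suc n))) (cong proj₁ (sym tribTriple-+2))
  where
  open ≡-Reasoning
  tribTriple-+2 : tribTriple (n + + 2) ≡ step (step (tribTriple n))
  tribTriple-+2 = begin
    tribTriple (n + + 2)        ≡⟨ cong tribTriple (sym (ℤ.+-assoc n 1ℤ 1ℤ)) ⟩
    tribTriple (n + 1ℤ + 1ℤ)    ≡⟨ tribTriple-suc (n + 1ℤ) ⟩
    step (tribTriple (n + 1ℤ))  ≡⟨ cong step (tribTriple-suc n) ⟩
    step (step (tribTriple n))  ∎

step-reflects-IsTrib : ∀ v → IsTrib (step v) → IsTrib v
step-reflects-IsTrib v (n , step-v≡Tₙ) = n - 1ℤ , (begin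
  v                     ≡⟨ sym (back-step v) ⟩
  back (step v)         ≡⟨ cong back step-v≡Tₙ ⟩
  back (tribTriple n)   ≡⟨ tribTriple-pred n ⟩
  tribTriple (n - 1ℤ)   ∎)
  where open ≡-Reasoning

back-reflects-IsTrib : ∀ v → IsTrib (back v) → IsTrib v
back-reflects-IsTrib v (n , back-v≡Tₙ) = n + 1ℤ , (begin
  v                     ≡⟨ sym (step-back v) ⟩
  step (back v)         ≡⟨ cong step back-v≡Tₙ ⟩
  step (tribTriple n)   ≡⟨ sym (tribTriple-suc n) ⟩
  tribTriple (n + 1ℤ)   ∎)
  where open ≡-Reasoning

-- Linear symmetries of P

record Symmetry : Set where
  field
    apply         : V → V
    linear        : ∀ A B C g → apply (comb A B C g) ≡ comb A B C (map₃ apply g)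
    P-invariant   : ∀ v → P (apply v) ≡ P v
    reflects-trib : ∀ v → IsTrib (apply v) → IsTrib v

open Symmetry

_∘ˢ_ : Symmetry → Symmetry → Symmetry
f ∘ˢ h = record
  { apply         = apply f ∘ apply h
  ; linear        = λ A B C g → trans (cong (apply f) (linear h A B C g)) (linear f A B C (map₃ (apply h) g))
  ; P-invariant   = λ v → trans (P-invariant f (apply h v)) (P-invariant h v)
  ; reflects-trib = λ v → reflects-trib h v ∘ reflects-trib f (apply h v)
  }

step-linear : ∀ A B C g → step (comb A B C g) ≡ comb A B C (map₃ step g)
step-linear A B C ((x₁ , y₁ , z₁) , (x₂ , y₂ , z₂) , (x₃ , y₃ , z₃)) =
  pointwise refl refl (regroup A B C x₁ y₁ z₁ x₂ y₂ z₂ x₃ y₃ z₃)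
  where
  regroup : ∀ A B C x₁ y₁ z₁ x₂ y₂ z₂ x₃ y₃ z₃ →
            A * x₁ + B * x₂ + C * x₃ + (A * y₁ + B * y₂ + C * y₃) + (A * z₁ + B * z₂ + C * z₃) ≡
            A * (x₁ + y₁ + z₁) + B * (x₂ + y₂ + z₂) + C * (x₃ + y₃ + z₃)
  regroup = solve-∀

back-linear : ∀ A B C g → back (comb A B C g) ≡ comb A B C (map₃ back g)
back-linear A B C ((x₁ , y₁ , z₁) , (x₂ , y₂ , z₂) , (x₃ , y₃ , z₃)) =
  pointwise (regroup A B C x₁ y₁ z₁ x₂ y₂ z₂ x₃ y₃ z₃) refl refl
  where
  regroup : ∀ A B C x₁ y₁ z₁ x₂ y₂ z₂ x₃ y₃ z₃ →
            A * z₁ + B * z₂ + C * z₃ - (A * y₁ + B * y₂ + C * y₃) - (A * x₁ + B * x₂ + C * x₃) ≡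
            A * (z₁ - y₁ - x₁) + B * (z₂ - y₂ - x₂) + C * (z₃ - y₃ - x₃)
  regroup = solve-∀

P-step : ∀ v → P (step v) ≡ P v
P-step (x , y , z) = solve 3 (λ x y z → Syntax.P (Syntax.forward (x , y , z)) ⊜ Syntax.P (x , y , z)) refl x y z

P-back : ∀ v → P (back v) ≡ P v
P-back (x , y , z) = solve 3 (λ x y z → Syntax.P (Syntax.backward (x , y , z)) ⊜ Syntax.P (x , y , z)) refl x y z

step-symmetry : Symmetry
step-symmetry = record
  { apply = step ; linear = step-linear ; P-invariant = P-step ; reflects-trib = step-reflects-IsTrib }

back-symmetry : Symmetry
back-symmetry = record
  { apply = back ; linear = back-linear ; P-invariant = P-back ; reflects-trib = back-reflects-IsTrib }

step²-symmetry : Symmetry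
step²-symmetry = step-symmetry ∘ˢ step-symmetry

-- Cones and their subdivision

Covered : (V → Set) → Cone → Set
Covered Q g = ∀ a b c → Q (comb (+ a) (+ b) (+ c) g)

data WeightOrder : ℕ → ℕ → Set where
  first-larger  : ∀ b d → WeightOrder (b ℕ.+ d) b
  second-larger : ∀ a d → WeightOrder a (a ℕ.+ d)

weightOrder : ∀ a b → WeightOrder a b
weightOrder a b with ℕ.≤-total b a
... | inj₁ b≤a = let d , b+d≡a = ℕ.m≤n⇒∃[o]m+o≡n b≤a in
  subst (λ a → WeightOrder a b) b+d≡a (first-larger b d)
... | inj₂ a≤b = let d , a+d≡b = ℕ.m≤n⇒∃[o]m+o≡n a≤b in
  subst (WeightOrder a) a+d≡b (second-larger a d)

comb-split₁₂ˡ : ∀ B C D g₁ g₂ g₃ → comb (B + D) B C (g₁ , g₂ , g₃) ≡ comb D B C (g₁ , g₁ +ᵥ g₂ , g₃)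
comb-split₁₂ˡ B C D (x₁ , y₁ , z₁) (x₂ , y₂ , z₂) (x₃ , y₃ , z₃) =
  pointwise (shear B C D x₁ x₂ x₃) (shear B C D y₁ y₂ y₃) (shear B C D z₁ z₂ z₃)
  where
  shear : ∀ B C D x₁ x₂ x₃ → (B + D) * x₁ + B * x₂ + C * x₃ ≡ D * x₁ + B * (x₁ + x₂) + C * x₃
  shear = solve-∀

comb-split₁₂ʳ : ∀ A C D g₁ g₂ g₃ → comb A (A + D) C (g₁ , g₂ , g₃) ≡ comb A D C (g₁ +ᵥ g₂ , g₂ , g₃)
comb-split₁₂ʳ A C D (x₁ , y₁ , z₁) (x₂ , y₂ , z₂) (x₃ , y₃ , z₃) =
  pointwise (shear A C D x₁ x₂ x₃) (shear A C D y₁ y₂ y₃) (shear A C D z₁ z₂ z₃)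
  where
  shear : ∀ A C D x₁ x₂ x₃ → A * x₁ + (A + D) * x₂ + C * x₃ ≡ A * (x₁ + x₂) + D * x₂ + C * x₃
  shear = solve-∀

comb-split₁₃ˡ : ∀ B C D g₁ g₂ g₃ → comb (C + D) B C (g₁ , g₂ , g₃) ≡ comb D B C (g₁ , g₂ , g₁ +ᵥ g₃)
comb-split₁₃ˡ B C D (x₁ , y₁ , z₁) (x₂ , y₂ , z₂) (x₃ , y₃ , z₃) =
  pointwise (shear B C D x₁ x₂ x₃) (shear B C D y₁ y₂ y₃) (shear B C D z₁ z₂ z₃)
  where
  shear : ∀ B C D x₁ x₂ x₃ → (C + D) * x₁ + B * x₂ + C * x₃ ≡ D * x₁ + B * x₂ + C * (x₁ + x₃)
  shear = solve-∀

comb-split₁₃ʳ : ∀ A B D g₁ g₂ g₃ → comb A B (A + D) (g₁ , g₂ , g₃) ≡ comb A B D (g₁ +ᵥ g₃ , g₂ , g₃)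
comb-split₁₃ʳ A B D (x₁ , y₁ , z₁) (x₂ , y₂ , z₂) (x₃ , y₃ , z₃) =
  pointwise (shear A B D x₁ x₂ x₃) (shear A B D y₁ y₂ y₃) (shear A B D z₁ z₂ z₃)
  where
  shear : ∀ A B D x₁ x₂ x₃ → A * x₁ + B * x₂ + (A + D) * x₃ ≡ A * (x₁ + x₃) + B * x₂ + D * x₃
  shear = solve-∀

comb-split₂₃ˡ : ∀ A C D g₁ g₂ g₃ → comb A (C + D) C (g₁ , g₂ , g₃) ≡ comb A D C (g₁ , g₂ , g₂ +ᵥ g₃)
comb-split₂₃ˡ A C D (x₁ , y₁ , z₁) (x₂ , y₂ , z₂) (x₃ , y₃ , z₃) =
  pointwise (shear A C D x₁ x₂ x₃) (shear A C D y₁ y₂ y₃) (shear A C D z₁ z₂ z₃)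
  where
  shear : ∀ A C D x₁ x₂ x₃ → A * x₁ + (C + D) * x₂ + C * x₃ ≡ A * x₁ + D * x₂ + C * (x₂ + x₃)
  shear = solve-∀

comb-split₂₃ʳ : ∀ A B D g₁ g₂ g₃ → comb A B (B + D) (g₁ , g₂ , g₃) ≡ comb A B D (g₁ , g₂ +ᵥ g₃ , g₃)
comb-split₂₃ʳ A B D (x₁ , y₁ , z₁) (x₂ , y₂ , z₂) (x₃ , y₃ , z₃) =
  pointwise (shear A B D x₁ x₂ x₃) (shear A B D y₁ y₂ y₃) (shear A B D z₁ z₂ z₃)
  where
  shear : ∀ A B D x₁ x₂ x₃ → A * x₁ + B * x₂ + (B + D) * x₃ ≡ A * x₁ + B * (x₂ + x₃) + D * x₃
  shear = solve-∀

module _ {Q : V → Set} {g₁ g₂ g₃ : V} where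

  split₁₂-covered : Covered Q (g₁ , g₁ +ᵥ g₂ , g₃) → Covered Q (g₁ +ᵥ g₂ , g₂ , g₃) → Covered Q (g₁ , g₂ , g₃)
  split₁₂-covered left right a b c with weightOrder a b
  ... | first-larger b d  = subst Q (sym (comb-split₁₂ˡ (+ b) (+ c) (+ d) g₁ g₂ g₃)) (left d b c)
  ... | second-larger a d = subst Q (sym (comb-split₁₂ʳ (+ a) (+ c) (+ d) g₁ g₂ g₃)) (right a d c)

  split₁₃-covered : Covered Q (g₁ , g₂ , g₁ +ᵥ g₃) → Covered Q (g₁ +ᵥ g₃ , g₂ , g₃) → Covered Q (g₁ , g₂ , g₃)
  split₁₃-covered left right a b c with weightOrder a c
  ... | first-larger c d  = subst Q (sym (comb-split₁₃ˡ (+ b) (+ c) (+ d) g₁ g₂ g₃)) (left d b c)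
  ... | second-larger a d = subst Q (sym (comb-split₁₃ʳ (+ a) (+ b) (+ d) g₁ g₂ g₃)) (right a b d)

  split₂₃-covered : Covered Q (g₁ , g₂ , g₂ +ᵥ g₃) → Covered Q (g₁ , g₂ +ᵥ g₃ , g₃) → Covered Q (g₁ , g₂ , g₃)
  split₂₃-covered left right a b c with weightOrder b c
  ... | first-larger c d  = subst Q (sym (comb-split₂₃ˡ (+ a) (+ c) (+ d) g₁ g₂ g₃)) (left a d c)
  ... | second-larger b d = subst Q (sym (comb-split₂₃ʳ (+ a) (+ b) (+ d) g₁ g₂ g₃)) (right a b d)

comb-unit₁ : ∀ g₁ g₂ g₃ → comb 1ℤ 0ℤ 0ℤ (g₁ , g₂ , g₃) ≡ g₁
comb-unit₁ (x₁ , y₁ , z₁) (x₂ , y₂ , z₂) (x₃ , y₃ , z₃) =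
  pointwise (select x₁ x₂ x₃) (select y₁ y₂ y₃) (select z₁ z₂ z₃)
  where
  select : ∀ x₁ x₂ x₃ → 1ℤ * x₁ + 0ℤ * x₂ + 0ℤ * x₃ ≡ x₁
  select = solve-∀

comb-unit₂ : ∀ g₁ g₂ g₃ → comb 0ℤ 1ℤ 0ℤ (g₁ , g₂ , g₃) ≡ g₂
comb-unit₂ (x₁ , y₁ , z₁) (x₂ , y₂ , z₂) (x₃ , y₃ , z₃) =
  pointwise (select x₁ x₂ x₃) (select y₁ y₂ y₃) (select z₁ z₂ z₃)
  where
  select : ∀ x₁ x₂ x₃ → 0ℤ * x₁ + 1ℤ * x₂ + 0ℤ * x₃ ≡ x₂
  select = solve-∀

comb-unit₃ : ∀ g₁ g₂ g₃ → comb 0ℤ 0ℤ 1ℤ (g₁ , g₂ , g₃) ≡ g₃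
comb-unit₃ (x₁ , y₁ , z₁) (x₂ , y₂ , z₂) (x₃ , y₃ , z₃) =
  pointwise (select x₁ x₂ x₃) (select y₁ y₂ y₃) (select z₁ z₂ z₃)
  where
  select : ∀ x₁ x₂ x₃ → 0ℤ * x₁ + 0ℤ * x₂ + 1ℤ * x₃ ≡ x₃
  select = solve-∀

All₃-unit-comb : ∀ {Q : V → Set} a b c g → a ℕ.+ b ℕ.+ c ≡ 1 → All₃ Q g → Q (comb (+ a) (+ b) (+ c) g)
All₃-unit-comb {Q} 1 0 0 (g₁ , g₂ , g₃) _ (q₁ , _ , _) = subst Q (sym (comb-unit₁ g₁ g₂ g₃)) q₁
All₃-unit-comb {Q} 0 1 0 (g₁ , g₂ , g₃) _ (_ , q₂ , _) = subst Q (sym (comb-unit₂ g₁ g₂ g₃)) q₂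
All₃-unit-comb {Q} 0 0 1 (g₁ , g₂ , g₃) _ (_ , _ , q₃) = subst Q (sym (comb-unit₃ g₁ g₂ g₃)) q₃
All₃-unit-comb 0             0             0             _ ()
All₃-unit-comb 0             0             (suc (suc _)) _ ()
All₃-unit-comb 0             1             (suc _)       _ ()
All₃-unit-comb 0             (suc (suc _)) _             _ ()
All₃-unit-comb 1             0             (suc _)       _ ()
All₃-unit-comb 1             (suc _)       _             _ ()
All₃-unit-comb (suc (suc _)) _             _             _ ()

‖+ᵥ‖≤ : ∀ u w → ‖ u +ᵥ w ‖ ℕ.≤ ‖ u ‖ ℕ.+ ‖ w ‖
‖+ᵥ‖≤ (x , y , z) (x′ , y′ , z′) =
  ℕ.≤-trans (ℕ.+-mono-≤ (ℕ.+-mono-≤ (ℤ.∣i+j∣≤∣i∣+∣j∣ x x′) (ℤ.∣i+j∣≤∣i∣+∣j∣ y y′)) (ℤ.∣i+j∣≤∣i∣+∣j∣ z z′))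
            (ℕ.≤-reflexive (regroup (∣ x ∣) (∣ x′ ∣) (∣ y ∣) (∣ y′ ∣) (∣ z ∣) (∣ z′ ∣)))
  where
  regroup : ∀ a a′ b b′ c c′ →
            a ℕ.+ a′ ℕ.+ (b ℕ.+ b′) ℕ.+ (c ℕ.+ c′) ≡ a ℕ.+ b ℕ.+ c ℕ.+ (a′ ℕ.+ b′ ℕ.+ c′)
  regroup = ℕ-Ring.solve-∀

‖·‖ : ∀ k v → ‖ k · v ‖ ≡ ∣ k ∣ ℕ.* ‖ v ‖
‖·‖ k (x , y , z) =
  trans (cong₂ ℕ._+_ (cong₂ ℕ._+_ (ℤ.abs-* k x) (ℤ.abs-* k y)) (ℤ.abs-* k z))
        (sym (distrib (∣ k ∣) (∣ x ∣) (∣ y ∣) (∣ z ∣)))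
  where
  distrib : ∀ k a b c → k ℕ.* (a ℕ.+ b ℕ.+ c) ≡ k ℕ.* a ℕ.+ k ℕ.* b ℕ.+ k ℕ.* c
  distrib = ℕ-Ring.solve-∀

‖comb‖≤ : ∀ A B C g₁ g₂ g₃ →
          ‖ comb A B C (g₁ , g₂ , g₃) ‖ ℕ.≤ ∣ A ∣ ℕ.* ‖ g₁ ‖ ℕ.+ ∣ B ∣ ℕ.* ‖ g₂ ‖ ℕ.+ ∣ C ∣ ℕ.* ‖ g₃ ‖
‖comb‖≤ A B C g₁ g₂ g₃ = begin
  ‖ A · g₁ +ᵥ B · g₂ +ᵥ C · g₃ ‖          ≤⟨ ‖+ᵥ‖≤ (A · g₁ +ᵥ B · g₂) (C · g₃) ⟩
  ‖ A · g₁ +ᵥ B · g₂ ‖ ℕ.+ ‖ C · g₃ ‖     ≤⟨ ℕ.+-monoˡ-≤ ‖ C · g₃ ‖ (‖+ᵥ‖≤ (A · g₁) (B · g₂)) ⟩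
  ‖ A · g₁ ‖ ℕ.+ ‖ B · g₂ ‖ ℕ.+ ‖ C · g₃ ‖ ≡⟨ cong₂ ℕ._+_ (cong₂ ℕ._+_ (‖·‖ A g₁) (‖·‖ B g₂)) (‖·‖ C g₃) ⟩
  ∣ A ∣ ℕ.* ‖ g₁ ‖ ℕ.+ ∣ B ∣ ℕ.* ‖ g₂ ‖ ℕ.+ ∣ C ∣ ℕ.* ‖ g₃ ‖ ∎
  where open ℕ.≤-Reasoning

Signs : Set
Signs = Sign × Sign × Sign

signs : V → Signs
signs (x , y , z) = (sign x , sign y , sign z)

signVector : Signs → V
signVector (s₁ , s₂ , s₃) = (s₁ ◃ 1 , s₂ ◃ 1 , s₃ ◃ 1)

InOrthant : Signs → V → Set
InOrthant σ v = signVector σ ∙ v ≡ + ‖ v ‖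

i≤+∣i∣ : ∀ i → i ≤ + ∣ i ∣
i≤+∣i∣ (+ n)    = ℤ.≤-refl
i≤+∣i∣ -[1+ n ] = -≤+

sign◃1*i≤∣i∣ : ∀ s i → (s ◃ 1) * i ≤ + ∣ i ∣
sign◃1*i≤∣i∣ Sign.+ i = subst (_≤ + ∣ i ∣) (sym (ℤ.*-identityˡ i)) (i≤+∣i∣ i)
sign◃1*i≤∣i∣ Sign.- i = subst₂ _≤_ (sym (ℤ.-1*i≡-i i)) (cong +_ (ℤ.∣-i∣≡∣i∣ i)) (i≤+∣i∣ (- i))

signVector∙≤‖‖ : ∀ σ v → signVector σ ∙ v ≤ + ‖ v ‖
signVector∙≤‖‖ (s₁ , s₂ , s₃) (x , y , z) =
  ℤ.+-mono-≤ (ℤ.+-mono-≤ (sign◃1*i≤∣i∣ s₁ x) (sign◃1*i≤∣i∣ s₂ y)) (sign◃1*i≤∣i∣ s₃ z)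

∙-comb : ∀ u A B C g₁ g₂ g₃ → u ∙ comb A B C (g₁ , g₂ , g₃) ≡ A * (u ∙ g₁) + B * (u ∙ g₂) + C * (u ∙ g₃)
∙-comb (p , q , r) A B C (x₁ , y₁ , z₁) (x₂ , y₂ , z₂) (x₃ , y₃ , z₃) =
  solve 15 (λ p q r A B C x₁ y₁ z₁ x₂ y₂ z₂ x₃ y₃ z₃ →
             let u = (p , q , r); g₁ = (x₁ , y₁ , z₁); g₂ = (x₂ , y₂ , z₂); g₃ = (x₃ , y₃ , z₃) in
             u Syntax.∙ Syntax.comb A B C (g₁ , g₂ , g₃) ⊜
             (A E.⊗ (u Syntax.∙ g₁) E.⊕ B E.⊗ (u Syntax.∙ g₂) E.⊕ C E.⊗ (u Syntax.∙ g₃)))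
        refl p q r A B C x₁ y₁ z₁ x₂ y₂ z₂ x₃ y₃ z₃

weighted≤‖comb‖ : ∀ σ a b c g₁ g₂ g₃ → All₃ (InOrthant σ) (g₁ , g₂ , g₃) →
                  a ℕ.* ‖ g₁ ‖ ℕ.+ b ℕ.* ‖ g₂ ‖ ℕ.+ c ℕ.* ‖ g₃ ‖ ℕ.≤ ‖ comb (+ a) (+ b) (+ c) (g₁ , g₂ , g₃) ‖
weighted≤‖comb‖ σ a b c g₁ g₂ g₃ (g₁∈σ , g₂∈σ , g₃∈σ) = ℤ.drop‿+≤+ (begin
  + (a ℕ.* ‖ g₁ ‖ ℕ.+ b ℕ.* ‖ g₂ ‖ ℕ.+ c ℕ.* ‖ g₃ ‖)
    ≡⟨ cong₂ _+_ (cong₂ _+_ (term a g₁ g₁∈σ) (term b g₂ g₂∈σ)) (term c g₃ g₃∈σ) ⟩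
  + a * (u ∙ g₁) + + b * (u ∙ g₂) + + c * (u ∙ g₃)
    ≡⟨ ∙-comb u (+ a) (+ b) (+ c) g₁ g₂ g₃ ⟨
  u ∙ comb (+ a) (+ b) (+ c) (g₁ , g₂ , g₃)
    ≤⟨ signVector∙≤‖‖ σ _ ⟩
  + ‖ comb (+ a) (+ b) (+ c) (g₁ , g₂ , g₃) ‖ ∎)
  where
  open ℤ.≤-Reasoning
  u = signVector σ
  term : ∀ k g → InOrthant σ g → + (k ℕ.* ‖ g ‖) ≡ + k * (u ∙ g)
  term k g g∈σ = trans (ℤ.pos-* k ‖ g ‖) (cong (+ k *_) (sym g∈σ))

weighted-< : ∀ a b c {x₁ x₂ x₃ y₁ y₂ y₃} → 0 ℕ.< a ℕ.+ b ℕ.+ c →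
             x₁ ℕ.< y₁ → x₂ ℕ.< y₂ → x₃ ℕ.< y₃ →
             a ℕ.* x₁ ℕ.+ b ℕ.* x₂ ℕ.+ c ℕ.* x₃ ℕ.< a ℕ.* y₁ ℕ.+ b ℕ.* y₂ ℕ.+ c ℕ.* y₃
weighted-< (suc a) b c _ x₁<y₁ x₂<y₂ x₃<y₃ =
  ℕ.+-mono-<-≤ (ℕ.+-mono-<-≤ (ℕ.*-monoʳ-< (suc a) x₁<y₁) (ℕ.*-monoʳ-≤ b (ℕ.<⇒≤ x₂<y₂)))
               (ℕ.*-monoʳ-≤ c (ℕ.<⇒≤ x₃<y₃))
weighted-< zero (suc b) c _ _ x₂<y₂ x₃<y₃ =
  ℕ.+-mono-<-≤ (ℕ.*-monoʳ-< (suc b) x₂<y₂) (ℕ.*-monoʳ-≤ c (ℕ.<⇒≤ x₃<y₃))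
weighted-< zero zero (suc c) _ _ _ x₃<y₃ = ℕ.*-monoʳ-< (suc c) x₃<y₃

weights-nonzero : ∀ a b c g → P (comb (+ a) (+ b) (+ c) g) ≡ 1ℤ → 0 ℕ.< a ℕ.+ b ℕ.+ c
weights-nonzero zero    zero    zero    _ ()
weights-nonzero zero    zero    (suc c) _ _ = s≤s z≤n
weights-nonzero zero    (suc b) c       _ _ = s≤s z≤n
weights-nonzero (suc a) b       c       _ _ = s≤s z≤n

-- Descent

Reducible : V → Set
Reducible v = (∀ {w} → ‖ w ‖ ℕ.< ‖ v ‖ → Solved w) → Solved v

Descends : Symmetry → Signs → V → Set
Descends f σ u = ‖ apply f u ‖ ℕ.< ‖ u ‖ × InOrthant σ u

descent-covered : ∀ f σ {g} → All₃ (Descends f σ) g → Covered Reducible g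
descent-covered f σ {g₁ , g₂ , g₃} ((d₁ , g₁∈σ) , (d₂ , g₂∈σ) , (d₃ , g₃∈σ)) a b c smaller-solved P≡1 =
  reflects-trib f v (smaller-solved ‖fv‖<‖v‖ (trans (P-invariant f v) P≡1))
  where
  v = comb (+ a) (+ b) (+ c) (g₁ , g₂ , g₃)
  ‖fv‖<‖v‖ : ‖ apply f v ‖ ℕ.< ‖ v ‖
  ‖fv‖<‖v‖ = begin-strict
    ‖ apply f v ‖
      ≡⟨ cong ‖_‖ (linear f (+ a) (+ b) (+ c) (g₁ , g₂ , g₃)) ⟩
    ‖ comb (+ a) (+ b) (+ c) (apply f g₁ , apply f g₂ , apply f g₃) ‖
      ≤⟨ ‖comb‖≤ (+ a) (+ b) (+ c) (apply f g₁) (apply f g₂) (apply f g₃) ⟩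
    a ℕ.* ‖ apply f g₁ ‖ ℕ.+ b ℕ.* ‖ apply f g₂ ‖ ℕ.+ c ℕ.* ‖ apply f g₃ ‖
      <⟨ weighted-< a b c (weights-nonzero a b c _ P≡1) d₁ d₂ d₃ ⟩
    a ℕ.* ‖ g₁ ‖ ℕ.+ b ℕ.* ‖ g₂ ‖ ℕ.+ c ℕ.* ‖ g₃ ‖
      ≤⟨ weighted≤‖comb‖ σ a b c g₁ g₂ g₃ (g₁∈σ , g₂∈σ , g₃∈σ) ⟩
    ‖ v ‖ ∎
    where open ℕ.≤-Reasoning

-- P on a cone as a cubic form in the weights

P-comb : ∀ A B C g → P (comb A B C g) ≡
         dot (cubeCoefficients g) (cubes A B C) + dot (mixedCoefficients g) (mixedMonomials A B C)
P-comb A B C ((x₁ , y₁ , z₁) , (x₂ , y₂ , z₂) , (x₃ , y₃ , z₃)) =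
  solve 12 (λ A B C x₁ y₁ z₁ x₂ y₂ z₂ x₃ y₃ z₃ →
             let g = ((x₁ , y₁ , z₁) , (x₂ , y₂ , z₂) , (x₃ , y₃ , z₃)) in
             Syntax.P (Syntax.comb A B C g) ⊜
             (Syntax.dot (Syntax.cubeCoefficients g) (Syntax.cubes A B C) E.⊕
              Syntax.dot (Syntax.mixedCoefficients g) (Syntax.mixedMonomials A B C)))
        refl A B C x₁ y₁ z₁ x₂ y₂ z₂ x₃ y₃ z₃

sum : ∀ {n} → Vec ℤ n → ℤ
sum []       = 0ℤ
sum (m ∷ ms) = m + sum ms

dot-lower : ∀ {n} ℓ {cs ms : Vec ℤ n} → All (ℓ ≤_) cs → All (0ℤ ≤_) ms → ℓ * sum ms ≤ dot cs ms
dot-lower ℓ [] [] = ℤ.≤-reflexive (ℤ.*-zeroʳ ℓ)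
dot-lower ℓ {c ∷ cs} {m ∷ ms} (ℓ≤c ∷ ℓ≤cs) (0≤m ∷ 0≤ms) = begin
  ℓ * (m + sum ms)       ≡⟨ ℤ.*-distribˡ-+ ℓ m (sum ms) ⟩
  ℓ * m + ℓ * sum ms     ≤⟨ ℤ.+-mono-≤ (ℤ.*-monoʳ-≤-nonNeg m {{nonNegative 0≤m}} ℓ≤c) (dot-lower ℓ ℓ≤cs 0≤ms) ⟩
  c * m + dot cs ms      ∎
  where open ℤ.≤-Reasoning

dot-upper : ∀ {n} u {cs ms : Vec ℤ n} → All (_≤ u) cs → All (0ℤ ≤_) ms → dot cs ms ≤ u * sum ms
dot-upper u [] [] = ℤ.≤-reflexive (sym (ℤ.*-zeroʳ u))
dot-upper u {c ∷ cs} {m ∷ ms} (c≤u ∷ cs≤u) (0≤m ∷ 0≤ms) = begin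
  c * m + dot cs ms      ≤⟨ ℤ.+-mono-≤ (ℤ.*-monoʳ-≤-nonNeg m {{nonNegative 0≤m}} c≤u) (dot-upper u cs≤u 0≤ms) ⟩
  u * m + u * sum ms     ≡⟨ ℤ.*-distribˡ-+ u m (sum ms) ⟨
  u * (m + sum ms)       ∎
  where open ℤ.≤-Reasoning

+-monomial : ∀ x y z → + x * + y * + z ≡ + (x ℕ.* y ℕ.* z)
+-monomial x y z = trans (cong (_* + z) (sym (ℤ.pos-* x y))) (sym (ℤ.pos-* (x ℕ.* y) z))

monomial-nonNeg : ∀ x y z → 0ℤ ≤ + x * + y * + z
monomial-nonNeg x y z = subst (0ℤ ≤_) (sym (+-monomial x y z)) (+≤+ z≤n)

cubes-nonNeg : ∀ a b c → All (0ℤ ≤_) (cubes (+ a) (+ b) (+ c))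
cubes-nonNeg a b c = monomial-nonNeg a a a ∷ monomial-nonNeg b b b ∷ monomial-nonNeg c c c ∷ []

mixedMonomials-nonNeg : ∀ a b c → All (0ℤ ≤_) (mixedMonomials (+ a) (+ b) (+ c))
mixedMonomials-nonNeg a b c =
  monomial-nonNeg a a b ∷ monomial-nonNeg a b b ∷ monomial-nonNeg a a c ∷ monomial-nonNeg a c c ∷
  monomial-nonNeg b b c ∷ monomial-nonNeg b c c ∷ monomial-nonNeg a b c ∷ []

n≤n³ : ∀ n → + n ≤ + n * + n * + n
n≤n³ zero    = ℤ.≤-refl
n≤n³ (suc n) = subst (+ suc n ≤_) (sym (+-monomial (suc n) (suc n) (suc n))) (+≤+ (ℕ.m≤n*m (suc n) (suc n ℕ.* suc n)))

sum-cubes≥ : ∀ a b c → + (a ℕ.+ b ℕ.+ c) ≤ sum (cubes (+ a) (+ b) (+ c))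
sum-cubes≥ a b c = begin
  + (a ℕ.+ b ℕ.+ c)         ≡⟨ cong +_ (ℕ.+-assoc a b c) ⟩
  + a + (+ b + + c)         ≡⟨ cong (λ t → + a + (+ b + t)) (ℤ.+-identityʳ (+ c)) ⟨
  + a + (+ b + (+ c + 0ℤ))  ≤⟨ ℤ.+-mono-≤ (n≤n³ a) (ℤ.+-mono-≤ (n≤n³ b) (ℤ.+-mono-≤ (n≤n³ c) ℤ.≤-refl)) ⟩
  sum (cubes (+ a) (+ b) (+ c)) ∎
  where open ℤ.≤-Reasoning

P-comb-nonPos : ∀ a b c g → All (_≤ 0ℤ) (cubeCoefficients g) → All (_≤ 0ℤ) (mixedCoefficients g) →
                P (comb (+ a) (+ b) (+ c) g) ≤ 0ℤ
P-comb-nonPos a b c g cs≤0 ms≤0 = begin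
  P (comb (+ a) (+ b) (+ c) g)
    ≡⟨ P-comb (+ a) (+ b) (+ c) g ⟩
  dot (cubeCoefficients g) (cubes (+ a) (+ b) (+ c)) + dot (mixedCoefficients g) (mixedMonomials (+ a) (+ b) (+ c))
    ≤⟨ ℤ.+-mono-≤ (dot-upper 0ℤ cs≤0 (cubes-nonNeg a b c)) (dot-upper 0ℤ ms≤0 (mixedMonomials-nonNeg a b c)) ⟩
  0ℤ ∎
  where open ℤ.≤-Reasoning

weights≤P-comb : ∀ a b c g → All (1ℤ ≤_) (cubeCoefficients g) → All (0ℤ ≤_) (mixedCoefficients g) →
                 + (a ℕ.+ b ℕ.+ c) ≤ P (comb (+ a) (+ b) (+ c) g)
weights≤P-comb a b c g 1≤cs 0≤ms = begin
  + (a ℕ.+ b ℕ.+ c)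
    ≤⟨ sum-cubes≥ a b c ⟩
  sum (cubes (+ a) (+ b) (+ c))
    ≡⟨ trans (ℤ.+-identityʳ _) (ℤ.*-identityˡ _) ⟨
  1ℤ * sum (cubes (+ a) (+ b) (+ c)) + 0ℤ * sum (mixedMonomials (+ a) (+ b) (+ c))
    ≤⟨ ℤ.+-mono-≤ (dot-lower 1ℤ 1≤cs (cubes-nonNeg a b c)) (dot-lower 0ℤ 0≤ms (mixedMonomials-nonNeg a b c)) ⟩
  dot (cubeCoefficients g) (cubes (+ a) (+ b) (+ c)) + dot (mixedCoefficients g) (mixedMonomials (+ a) (+ b) (+ c))
    ≡⟨ P-comb (+ a) (+ b) (+ c) g ⟨
  P (comb (+ a) (+ b) (+ c) g) ∎
  where open ℤ.≤-Reasoning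

negative-covered : ∀ {g} → All (_≤ 0ℤ) (cubeCoefficients g) → All (_≤ 0ℤ) (mixedCoefficients g) → Covered Solved g
negative-covered {g} cs≤0 ms≤0 a b c P≡1 =
  contradiction (subst (_≤ 0ℤ) P≡1 (P-comb-nonPos a b c g cs≤0 ms≤0)) λ { (+≤+ ()) }

positive-covered : ∀ {g} → All (1ℤ ≤_) (cubeCoefficients g) → All (0ℤ ≤_) (mixedCoefficients g) →
                   All₃ Solved g → Covered Solved g
positive-covered {g} 1≤cs 0≤ms generators-solved a b c P≡1 =
  All₃-unit-comb {Solved} a b c g weights-sum≡1 generators-solved P≡1
  where
  weights-sum≡1 : a ℕ.+ b ℕ.+ c ≡ 1
  weights-sum≡1 = ℕ.≤-antisym (ℤ.drop‿+≤+ (subst (_ ≤_) P≡1 (weights≤P-comb a b c g 1≤cs 0≤ms)))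
                              (weights-nonzero a b c g P≡1)

-- Certificates

data Certificate : Set where
  descend                 : Symmetry → Certificate
  negative                : Certificate
  positive                : ℤ → ℤ → ℤ → Certificate
  split₁₂ split₁₃ split₂₃ : Certificate → Certificate → Certificate

SolvedBy : ℤ → V → Set
SolvedBy n g = P g ≡ 1ℤ → g ≡ tribTriple n

Valid : Signs → Cone → Certificate → Set
Valid σ g (descend f) = All₃ (Descends f σ) g
Valid σ g negative    = All (_≤ 0ℤ) (cubeCoefficients g) × All (_≤ 0ℤ) (mixedCoefficients g)
Valid σ g@(g₁ , g₂ , g₃) (positive n₁ n₂ n₃) =
  All (1ℤ ≤_) (cubeCoefficients g) × All (0ℤ ≤_) (mixedCoefficients g) ×
  SolvedBy n₁ g₁ × SolvedBy n₂ g₂ × SolvedBy n₃ g₃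
Valid σ (g₁ , g₂ , g₃) (split₁₂ l r) = Valid σ (g₁ , g₁ +ᵥ g₂ , g₃) l × Valid σ (g₁ +ᵥ g₂ , g₂ , g₃) r
Valid σ (g₁ , g₂ , g₃) (split₁₃ l r) = Valid σ (g₁ , g₂ , g₁ +ᵥ g₃) l × Valid σ (g₁ +ᵥ g₃ , g₂ , g₃) r
Valid σ (g₁ , g₂ , g₃) (split₂₃ l r) = Valid σ (g₁ , g₂ , g₂ +ᵥ g₃) l × Valid σ (g₁ , g₂ +ᵥ g₃ , g₃) r

valid? : ∀ σ g t → Dec (Valid σ g t)
valid? σ g (descend f) =
  all₃? (λ u → (‖ apply f u ‖ ℕ.<? ‖ u ‖) ×-dec (signVector σ ∙ u ℤ.≟ + ‖ u ‖)) g
valid? σ g negative = all? (_≤? 0ℤ) (cubeCoefficients g) ×-dec all? (_≤? 0ℤ) (mixedCoefficients g)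
valid? σ g@(g₁ , g₂ , g₃) (positive n₁ n₂ n₃) =
  all? (1ℤ ≤?_) (cubeCoefficients g) ×-dec all? (0ℤ ≤?_) (mixedCoefficients g) ×-dec
  solvedBy? n₁ g₁ ×-dec solvedBy? n₂ g₂ ×-dec solvedBy? n₃ g₃
  where
  solvedBy? : ∀ n g → Dec (SolvedBy n g)
  solvedBy? n g = (P g ℤ.≟ 1ℤ) →-dec ×.≡-dec ℤ._≟_ (×.≡-dec ℤ._≟_ ℤ._≟_) g (tribTriple n)
valid? σ (g₁ , g₂ , g₃) (split₁₂ l r) = valid? σ _ l ×-dec valid? σ _ r
valid? σ (g₁ , g₂ , g₃) (split₁₃ l r) = valid? σ _ l ×-dec valid? σ _ r
valid? σ (g₁ , g₂ , g₃) (split₂₃ l r) = valid? σ _ l ×-dec valid? σ _ r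

valid⇒covered : ∀ σ g t → Valid σ g t → Covered Reducible g
valid⇒covered σ g (descend f) decreasing = descent-covered f σ decreasing
valid⇒covered σ g negative (cs≤0 , ms≤0) a b c _ = negative-covered cs≤0 ms≤0 a b c
valid⇒covered σ g (positive n₁ n₂ n₃) (1≤cs , 0≤ms , s₁ , s₂ , s₃) a b c _ =
  positive-covered 1≤cs 0≤ms (solved-by n₁ s₁ , solved-by n₂ s₂ , solved-by n₃ s₃) a b c
  where
  solved-by : ∀ n {u} → SolvedBy n u → Solved u
  solved-by n s P≡1 = n , s P≡1
valid⇒covered σ (g₁ , g₂ , g₃) (split₁₂ l r) (vl , vr) =
  split₁₂-covered {Reducible} {g₁} {g₂} {g₃} (valid⇒covered σ _ l vl) (valid⇒covered σ _ r vr)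
valid⇒covered σ (g₁ , g₂ , g₃) (split₁₃ l r) (vl , vr) =
  split₁₃-covered {Reducible} {g₁} {g₂} {g₃} (valid⇒covered σ _ l vl) (valid⇒covered σ _ r vr)
valid⇒covered σ (g₁ , g₂ , g₃) (split₂₃ l r) (vl , vr) =
  split₂₃-covered {Reducible} {g₁} {g₂} {g₃} (valid⇒covered σ _ l vl) (valid⇒covered σ _ r vr)

orthantCone : Signs → Cone
orthantCone (s₁ , s₂ , s₃) = ((s₁ ◃ 1 , 0ℤ , 0ℤ) , (0ℤ , s₂ ◃ 1 , 0ℤ) , (0ℤ , 0ℤ , s₃ ◃ 1))

∣i∣*sign◃1 : ∀ i → + ∣ i ∣ * (sign i ◃ 1) ≡ i
∣i∣*sign◃1 (+ n)    = ℤ.*-identityʳ (+ n)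
∣i∣*sign◃1 -[1+ n ] = cong -[1+_] (ℕ.*-identityʳ n)

comb-diagonal : ∀ A B C p q r →
                comb A B C ((p , 0ℤ , 0ℤ) , (0ℤ , q , 0ℤ) , (0ℤ , 0ℤ , r)) ≡ (A * p , B * q , C * r)
comb-diagonal A B C p q r = pointwise (e₁ A B C p) (e₂ A B C q) (e₃ A B C r)
  where
  e₁ : ∀ A B C p → A * p + B * 0ℤ + C * 0ℤ ≡ A * p
  e₁ = solve-∀
  e₂ : ∀ A B C q → A * 0ℤ + B * q + C * 0ℤ ≡ B * q
  e₂ = solve-∀
  e₃ : ∀ A B C r → A * 0ℤ + B * 0ℤ + C * r ≡ C * r
  e₃ = solve-∀

orthant-decomposition : ∀ x y z →
                        comb (+ ∣ x ∣) (+ ∣ y ∣) (+ ∣ z ∣) (orthantCone (signs (x , y , z))) ≡ (x , y , z)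
orthant-decomposition x y z =
  trans (comb-diagonal (+ ∣ x ∣) (+ ∣ y ∣) (+ ∣ z ∣) (sign x ◃ 1) (sign y ◃ 1) (sign z ◃ 1))
        (pointwise (∣i∣*sign◃1 x) (∣i∣*sign◃1 y) (∣i∣*sign◃1 z))

-- Subdivision trees found by a computer search.
certificate : Signs → Certificate
certificate (Sign.+ , Sign.+ , Sign.+) =
  split₁₂ (split₁₃ (positive -1ℤ 0ℤ 0ℤ) (split₂₃ (positive 0ℤ 0ℤ 0ℤ) (split₂₃ (positive 0ℤ 0ℤ
    (+ 2)) (split₁₃ (descend back-symmetry) (split₂₃ (descend back-symmetry) (positive 0ℤ 0ℤ
    0ℤ)))))) (split₁₃ (positive 0ℤ 0ℤ 0ℤ) (split₂₃ (positive 0ℤ 0ℤ 1ℤ) (split₁₃ (split₁₂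
    (positive 0ℤ 0ℤ (+ 2)) (descend back-symmetry)) (split₂₃ (descend back-symmetry) (split₁₃
    (descend back-symmetry) (positive 0ℤ 0ℤ 0ℤ))))))
certificate (Sign.+ , Sign.+ , Sign.-) =
  split₁₂ (split₁₃ (split₂₃ (positive -1ℤ 0ℤ 0ℤ) (split₁₃ (positive -1ℤ 0ℤ -[1+ 3 ]) (split₂₃
    (positive -[1+ 3 ] 0ℤ 0ℤ) (descend step-symmetry)))) (split₂₃ (split₁₂ (split₁₃ (split₁₂
    (descend step-symmetry) (split₂₃ (positive 0ℤ 0ℤ 0ℤ) (descend step-symmetry))) (split₂₃
    (split₁₂ (split₁₃ (descend step-symmetry) (positive 0ℤ 0ℤ 0ℤ)) (positive 0ℤ 0ℤ 0ℤ))
    (split₁₃ (split₁₂ (descend step-symmetry) (positive 0ℤ 0ℤ 0ℤ)) (positive 0ℤ 0ℤ 0ℤ))))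
    (positive 0ℤ 0ℤ 0ℤ)) (split₂₃ (split₁₂ (descend step-symmetry) (split₂₃ (split₁₂ (descend
    step-symmetry) (split₂₃ (positive 0ℤ 0ℤ 0ℤ) (descend step-symmetry))) (descend
    step-symmetry))) negative))) (split₁₃ (positive 0ℤ 0ℤ 0ℤ) (split₂₃ (split₁₂ (split₁₃
    (positive 0ℤ 0ℤ 0ℤ) (split₂₃ (positive 0ℤ 0ℤ 0ℤ) (split₁₃ (positive 0ℤ 0ℤ 0ℤ) (split₂₃
    (positive 0ℤ 0ℤ 0ℤ) (split₂₃ (positive 0ℤ 0ℤ 0ℤ) (descend step²-symmetry)))))) (split₂₃
    (positive 0ℤ 0ℤ 0ℤ) (split₁₃ (positive 0ℤ 0ℤ 0ℤ) (split₁₃ (positive 0ℤ 0ℤ 0ℤ) (split₂₃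
    (positive 0ℤ 0ℤ 0ℤ) (split₁₃ (positive 0ℤ 0ℤ 0ℤ) (split₂₃ (positive 0ℤ 0ℤ 0ℤ) (descend
    step²-symmetry)))))))) (split₁₃ (split₁₂ (split₁₃ (split₁₂ (split₁₃ (positive 0ℤ 0ℤ 0ℤ)
    (descend step²-symmetry)) (descend step²-symmetry)) (descend step²-symmetry)) (descend
    step²-symmetry)) negative)))
certificate (Sign.+ , Sign.- , Sign.+) =
  split₁₂ (split₁₃ (split₂₃ (split₁₂ (positive -1ℤ 0ℤ 0ℤ) (split₂₃ (descend step-symmetry)
    (positive 0ℤ 0ℤ 0ℤ))) (positive -1ℤ 0ℤ 0ℤ)) (split₂₃ (split₁₂ (positive 0ℤ 0ℤ 0ℤ) (split₂₃
    (split₁₂ (positive 0ℤ 0ℤ 0ℤ) (descend step-symmetry)) (positive 0ℤ 0ℤ 0ℤ))) (positive 0ℤ 0ℤ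
    0ℤ))) (split₁₃ (split₂₃ negative (split₁₃ (descend step-symmetry) (split₂₃ (descend
    step-symmetry) (positive 0ℤ 0ℤ 0ℤ)))) (split₂₃ (split₁₂ (split₁₃ (split₁₂ (positive 0ℤ 0ℤ
    0ℤ) (descend step²-symmetry)) (descend step²-symmetry)) (split₂₃ negative (split₁₃ (split₁₂
    (descend step²-symmetry) (split₂₃ negative (descend step²-symmetry))) (split₁₃ (split₁₂
    (descend step²-symmetry) (split₂₃ negative (descend step²-symmetry))) (split₂₃ (split₁₂
    (split₁₃ (descend step²-symmetry) negative) negative) (split₁₃ (split₁₂ (descend
    step²-symmetry) (split₂₃ negative (descend step²-symmetry))) (split₂₃ (split₁₂ (descend
    step²-symmetry) negative) (descend step²-symmetry)))))))) (positive 0ℤ -[1+ 2 ] 0ℤ)))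
certificate (Sign.+ , Sign.- , Sign.-) =
  split₁₂ (split₁₃ (split₂₃ (split₁₂ (split₁₃ (split₁₂ (split₁₃ (positive -1ℤ 0ℤ 0ℤ) (descend
    step-symmetry)) (descend step-symmetry)) (descend step-symmetry)) (descend step-symmetry))
    (split₁₃ (split₁₂ (split₁₃ (split₁₂ (positive -1ℤ 0ℤ 0ℤ) (descend step-symmetry)) (descend
    step-symmetry)) (descend step-symmetry)) (descend step-symmetry))) (split₂₃ negative
    negative)) (split₁₃ negative (split₂₃ negative (split₁₃ negative (split₂₃ negative
    negative))))
certificate (Sign.- , Sign.+ , Sign.+) =
  split₁₂ (split₁₃ (split₂₃ (split₁₂ (split₁₃ (split₁₂ (split₁₃ negative (descend
    step-symmetry)) (descend step-symmetry)) (descend step-symmetry)) (descend step-symmetry))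
    (split₁₃ (split₁₂ (split₁₃ (split₁₂ negative (descend step-symmetry)) (descend
    step-symmetry)) (descend step-symmetry)) (descend step-symmetry))) (split₂₃ (positive 0ℤ
    -[1+ 1 ] 0ℤ) (positive 0ℤ 0ℤ 0ℤ))) (split₁₃ (positive -[1+ 1 ] 0ℤ 0ℤ) (split₂₃ (positive 0ℤ
    0ℤ 1ℤ) (split₁₃ (positive 0ℤ 1ℤ 0ℤ) (split₂₃ (positive 0ℤ 1ℤ 0ℤ) (positive 0ℤ 0ℤ 0ℤ)))))
certificate (Sign.- , Sign.+ , Sign.-) =
  split₁₂ (split₁₃ (split₂₃ (split₁₂ negative (split₂₃ (descend step-symmetry) negative))
    negative) (split₂₃ (split₁₂ negative (split₂₃ (split₁₂ negative (descend step-symmetry))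
    negative)) negative)) (split₁₃ (split₂₃ (positive -[1+ 1 ] 0ℤ 0ℤ) (split₁₃ (descend
    step-symmetry) (split₂₃ (descend step-symmetry) negative))) (split₂₃ (split₁₂ (split₁₃
    (split₁₂ negative (descend step²-symmetry)) (descend step²-symmetry)) (split₂₃ (positive 0ℤ
    0ℤ 0ℤ) (split₁₃ (split₁₂ (descend step²-symmetry) (split₂₃ (positive 0ℤ 0ℤ 0ℤ) (descend
    step²-symmetry))) (split₁₃ (split₁₂ (descend step²-symmetry) (split₂₃ (positive 0ℤ 0ℤ 0ℤ)
    (descend step²-symmetry))) (split₂₃ (split₁₂ (split₁₃ (descend step²-symmetry) (positive 0ℤ
    0ℤ 0ℤ)) (positive 0ℤ 0ℤ 0ℤ)) (split₁₃ (split₁₂ (descend step²-symmetry) (split₂₃ (positive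
    0ℤ 0ℤ 0ℤ) (descend step²-symmetry))) (split₂₃ (split₁₂ (descend step²-symmetry) (positive
    0ℤ 0ℤ 0ℤ)) (descend step²-symmetry)))))))) negative))
certificate (Sign.- , Sign.- , Sign.+) =
  split₁₂ (split₁₃ (split₂₃ negative (split₁₃ negative (split₂₃ negative (descend
    step-symmetry)))) (split₂₃ (split₁₂ (split₁₃ (split₁₂ (descend step-symmetry) (split₂₃
    negative (descend step-symmetry))) (split₂₃ (split₁₂ (split₁₃ (descend step-symmetry)
    negative) negative) (split₁₃ (split₁₂ (descend step-symmetry) negative) negative)))
    negative) (split₂₃ (split₁₂ (descend step-symmetry) (split₂₃ (split₁₂ (descend
    step-symmetry) (split₂₃ negative (descend step-symmetry))) (descend step-symmetry)))
    (positive 0ℤ 0ℤ 0ℤ)))) (split₁₃ negative (split₂₃ (split₁₂ (split₁₃ negative (split₂₃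
    negative (split₁₃ negative (split₂₃ negative (split₂₃ negative (descend
    step²-symmetry)))))) (split₂₃ negative (split₁₃ negative (split₁₃ negative (split₂₃
    negative (split₁₃ negative (split₂₃ negative (descend step²-symmetry)))))))) (split₁₃
    (split₁₂ (split₁₃ (split₁₂ (split₁₃ negative (descend step²-symmetry)) (descend
    step²-symmetry)) (descend step²-symmetry)) (descend step²-symmetry)) (positive 0ℤ -[1+ 2 ]
    0ℤ))))
certificate (Sign.- , Sign.- , Sign.-) =
  split₁₂ (split₁₃ negative (split₂₃ negative (split₂₃ negative (split₁₃ (descend
    back-symmetry) (split₂₃ (descend back-symmetry) negative))))) (split₁₃ negative (split₂₃
    negative (split₁₃ (split₁₂ negative (descend back-symmetry)) (split₂₃ (descend
    back-symmetry) (split₁₃ (descend back-symmetry) negative)))))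

certificate-valid : ∀ σ → Valid σ (orthantCone σ) (certificate σ)
certificate-valid σ = toWitness (checked σ)
  where
  checked : ∀ σ → True (valid? σ (orthantCone σ) (certificate σ))
  checked (Sign.+ , Sign.+ , Sign.+) = _
  checked (Sign.+ , Sign.+ , Sign.-) = _
  checked (Sign.+ , Sign.- , Sign.+) = _
  checked (Sign.+ , Sign.- , Sign.-) = _
  checked (Sign.- , Sign.+ , Sign.+) = _
  checked (Sign.- , Sign.+ , Sign.-) = _
  checked (Sign.- , Sign.- , Sign.+) = _
  checked (Sign.- , Sign.- , Sign.-) = _

every-point-reducible : ∀ v → Reducible v
every-point-reducible (x , y , z) = subst Reducible (orthant-decomposition x y z)
  (valid⇒covered σ (orthantCone σ) (certificate σ) (certificate-valid σ) (∣ x ∣) (∣ y ∣) (∣ z ∣))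
  where σ = signs (x , y , z)

solved : ∀ v → Solved v
solved = All.wfRec (On.wellFounded ‖_‖ <-wellFounded) 0ℓ Solved every-point-reducible

theorem3p4 : (x y z : ℤ) → P-T x y z ≡ + 1 →
    ∃ λ (n : ℤ) → (x , y , z) ≡ (T n , T (n + + 1) , T (n + + 2))
theorem3p4 x y z P≡1 =
  let n , xyz≡Tₙ = solved (x , y , z) P≡1 in n , trans xyz≡Tₙ (tribTriple-components n)
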